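{- Let $\mathbf P=(P,\leq,{}',0,1)$ be an orthogonal lub-complete poset and let $\rightarrow\in\{\rightarrow_C,\rightarrow_K,\rightarrow_N,\rightarrow_S,\rightarrow_D\}$. Then the following are equivalent: (i) for all $x,y,u,v\in P$: if $x\leq y$ and $x\rightarrow y\leq u\rightarrow v$, then $u\leq v$; (ii) for all $x,y\in P$: $x\leq y$ if and only if $x\rightarrow y=\{1\}$.
   Context: For a poset $(P,\leq)$ and $A,B\subseteq P$: $A\leq B$ means $a\leq b$ for all $a\in A$, $b\in B$. $L(A)=\{x: x\leq a\ \forall a\in A\}$, $U(A)=\{x: a\leq x\ \forall a\in A\}$, $L(x,y)=L(\{x,y\})$, $U(x,y)=U(\{x,y\})$. $\operatorname{Max}A$, $\operatorname{Min}A$: maximal/minimal elements of $A$. $x\vee y$, $x\wedge y$: supremum/infimum when they exist. A bounded poset $(P,\leq,{}',0,1)$ with antitone involution: $x\leq y\Rightarrow y'\leq x'$, $x''=x$. $x\perp y$ iff $x\leq y'$. Orthogonal: $x\perp y$ implies $x\vee y$ exists. Lub-complete: for every finite $M\subseteq P$ and lower bound $x$ of $M$ there is a maximal element of $L(M)$ above $x$. Implications $P^2\to 2^P$: $x\rightarrow_C y=\operatorname{Min}U(x',y)$; $x\rightarrow_K y=\{(a\vee b)\vee(x\wedge c): a\in\operatorname{Max}L(x',y), b\in\operatorname{Max}L(x',y'), c\in\operatorname{Min}U(x',y)\}$; $x\rightarrow_N y=y'\rightarrow_K x'$; $x\rightarrow_S y=\{x'\vee a: a\in\operatorname{Max}L(x,y)\}$;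 $x\rightarrow_D y=y'\rightarrow_S x'=\{y\vee b: b\in\operatorname{Max}L(x',y')\}$ (all suprema/infima used exist in an orthogonal lub-complete poset). -}

module Defs where

open import Level using (Level; suc)
open import Data.Product using (Σ; ∃; _×_; _,_)
open import Data.List using (List)
open import Data.List.Relation.Unary.All using (All)
open import Relation.Binary.PropositionalEquality using (_≡_)
open import Relation.Binary using (Rel)
open import Function.Bundles using (_⇔_)

record BoundedInvPoset (ℓ : Level) : Set (suc ℓ) where
  field
    Carrier : Set ℓ
    _≤_     : Rel Carrier ℓ
    ≤-refl  : ∀ {x} → x ≤ x
    ≤-trans : ∀ {x y z} → x ≤ y → y ≤ z → x ≤ z
    ≤-antisym : ∀ {x y} → x ≤ y → y ≤ x → x ≡ y
    _′      : Carrier → Carrier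
    𝟘       : Carrier
    𝟙       : Carrier
    𝟘-min   : ∀ x → 𝟘 ≤ x
    𝟙-max   : ∀ x → x ≤ 𝟙
    ′-antitone : ∀ {x y} → x ≤ y → (y ′) ≤ (x ′)
    ′-invol : ∀ x → ((x ′) ′) ≡ x

module Notions {ℓ : Level} (P : BoundedInvPoset ℓ) where
  open BoundedInvPoset P

  Subset : Set (suc ℓ)
  Subset = Carrier → Set ℓ

  _≤ˢ_ : Subset → Subset → Set ℓ
  A ≤ˢ B = ∀ a b → A a → B b → a ≤ b

  IsSingleton : Subset → Carrier → Set ℓ
  IsSingleton A z = ∀ w → (A w → w ≡ z) × (w ≡ z → A w)

  L₂ : Carrier → Carrier → Subset
  L₂ x y w = (w ≤ x) × (w ≤ y)

  U₂ : Carrier → Carrier → Subset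
  U₂ x y w = (x ≤ w) × (y ≤ w)

  Lᶠ : List Carrier → Subset
  Lᶠ M w = All (w ≤_) M

  Max : Subset → Subset
  Max A w = A w × (∀ z → A z → w ≤ z → z ≡ w)

  Min : Subset → Subset
  Min A w = A w × (∀ z → A z → z ≤ w → z ≡ w)

  IsSup : Carrier → Carrier → Carrier → Set ℓ
  IsSup x y s = U₂ x y s × (∀ z → U₂ x y z → s ≤ z)

  IsInf : Carrier → Carrier → Carrier → Set ℓ
  IsInf x y i = L₂ x y i × (∀ z → L₂ x y z → z ≤ i)

  _⊥_ : Carrier → Carrier → Set ℓ
  x ⊥ y = x ≤ (y ′)

  Orthogonal : Set ℓ
  Orthogonal = ∀ x y → x ⊥ y → ∃ λ s → IsSup x y s

  LubComplete : Set ℓ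
  LubComplete = ∀ (M : List Carrier) x → Lᶠ M x → ∃ λ w → Max (Lᶠ M) w × (x ≤ w)

  →C : Carrier → Carrier → Subset
  →C x y = Min (U₂ (x ′) y)

  -- (a ∨ b) ∨ (x ∧ c)
  →K : Carrier → Carrier → Subset
  →K x y z = Σ Carrier λ a → Σ Carrier λ b → Σ Carrier λ d → Σ Carrier λ s → Σ Carrier λ t →
      Max (L₂ (x ′) y) a × Max (L₂ (x ′) (y ′)) b × Min (U₂ (x ′) y) d
    × IsSup a b s × IsInf x d t × IsSup s t z

  →N : Carrier → Carrier → Subset
  →N x y = →K (y ′) (x ′)

  →S : Carrier → Carrier → Subset
  →S x y z = Σ Carrier λ a → Max (L₂ x y) a × IsSup (x ′) a z

  →D : Carrier → Carrier → Subset
  →D x y z = Σ Carrier λ b → Max (L₂ (x ′) (y ′)) b × IsSup y b z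

data Impl : Set where
  C K N S D : Impl

module _ {ℓ : Level} (P : BoundedInvPoset ℓ) where
  open BoundedInvPoset P
  open Notions P

  implOf : Impl → Carrier → Carrier → Subset
  implOf C = →C
  implOf K = →K
  implOf N = →N
  implOf S = →S
  implOf D = →D

  Cond-i : Impl → Set ℓ
  Cond-i i = ∀ x y u v → x ≤ y → implOf i x y ≤ˢ implOf i u v → u ≤ v

  Cond-ii : Impl → Set ℓ
  Cond-ii i = ∀ x y → (x ≤ y) ⇔ IsSingleton (implOf i x y) 𝟙

module Submission where

-- Both directions turn on one consequence of (i): x ∨ x′ = 1 for every x.
-- Indeed x → x lies below every upper bound z of x and x′, while z lies below
-- 1 → z, so (i) applied to x → x ≤ 1 → z gives 1 ≤ z. Conversely, when
-- x ∨ x′ = 1 and x ≤ y, every element of x → y is an upper bound of some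
-- element and its complement, hence equals 1; as x → y is inhabited (by
-- lub-completeness and orthogonality), x → y = {1}. Given (ii), the hypothesis
-- x → y ≤ u → v of (i) says that 1 lies below all of u → v, so u → v = {1}.

open import Defs
open import Level using (Level)
open import Function.Bundles using (_⇔_; mk⇔; Equivalence)
open import Data.Product using (∃; _,_; proj₁; proj₂)
open import Data.List using ([]; _∷_)
open import Data.List.Relation.Unary.All using ([]; _∷_)
open import Relation.Binary.PropositionalEquality using (_≡_; refl; sym; trans; cong; subst)

module _ {ℓ : Level} (P : BoundedInvPoset ℓ) where
  open BoundedInvPoset P
  open Notions P

  ≤-reflexive : ∀ {x y} → x ≡ y → x ≤ y
  ≤-reflexive refl = ≤-refl

  ′′-≤ : ∀ {x} → ((x ′) ′) ≤ x
  ′′-≤ {x} = ≤-reflexive (′-invol x)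

  ≤-′′ : ∀ {x} → x ≤ ((x ′) ′)
  ≤-′′ {x} = ≤-reflexive (sym (′-invol x))

  ⊥-sym : ∀ {x y} → x ⊥ y → y ⊥ x
  ⊥-sym x⊥y = ≤-trans ≤-′′ (′-antitone x⊥y)

  ′-swapˡ : ∀ {x y} → (x ′) ≤ y → (y ′) ≤ x
  ′-swapˡ x′≤y = ≤-trans (′-antitone x′≤y) ′′-≤

  Max-L₂-≤ˡ : ∀ {x y a} → x ≤ y → Max (L₂ x y) a → a ≡ x
  Max-L₂-≤ˡ x≤y ((a≤x , _) , maximal) = sym (maximal _ (≤-refl , x≤y) a≤x)

  Max-L₂-≤ʳ : ∀ {x y a} → y ≤ x → Max (L₂ x y) a → a ≡ y
  Max-L₂-≤ʳ y≤x ((_ , a≤y) , maximal) = sym (maximal _ (y≤x , ≤-refl) a≤y)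

  singleton-𝟙 : ∀ {A : Subset} → ∃ A → (∀ w → A w → w ≡ 𝟙) → IsSingleton A 𝟙
  singleton-𝟙 {A} (e , e∈A) all-𝟙 w =
    all-𝟙 w , λ w≡𝟙 → subst A (trans (all-𝟙 e e∈A) (sym w≡𝟙)) e∈A

  ReflectsOrder : (Carrier → Carrier → Subset) → Set ℓ
  ReflectsOrder _⇒_ = ∀ x y u v → x ≤ y → (x ⇒ y) ≤ˢ (u ⇒ v) → u ≤ v

  CharacterisesOrder : (Carrier → Carrier → Subset) → Set ℓ
  CharacterisesOrder _⇒_ = ∀ x y → (x ≤ y) ⇔ IsSingleton (x ⇒ y) 𝟙

  module _ {_⇒_ : Carrier → Carrier → Subset} where

    reflects⇒singleton⇒≤ : ReflectsOrder _⇒_ → ∀ {x y} → IsSingleton (x ⇒ y) 𝟙 → x ≤ y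
    reflects⇒singleton⇒≤ reflects {x} {y} x⇒y≡𝟙 =
      reflects 𝟙 𝟙 x y ≤-refl λ a b _ b∈x⇒y →
        ≤-trans (𝟙-max a) (≤-reflexive (sym (proj₁ (x⇒y≡𝟙 b) b∈x⇒y)))

    characterises⇒reflects : (∀ x y → ∃ (x ⇒ y)) → CharacterisesOrder _⇒_ → ReflectsOrder _⇒_
    characterises⇒reflects inhabited characterises x y u v x≤y x⇒y≤u⇒v =
      Equivalence.from (characterises u v) (singleton-𝟙 (inhabited u v) λ w w∈u⇒v →
        ≤-antisym (𝟙-max w) (x⇒y≤u⇒v 𝟙 w 𝟙∈x⇒y w∈u⇒v))
      where
      𝟙∈x⇒y : (x ⇒ y) 𝟙
      𝟙∈x⇒y = proj₂ (Equivalence.to (characterises x y) x≤y 𝟙) refl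

  -- x ∨ x′ = 1, phrased without presupposing that the join exists.
  Orthocomplemented : Set ℓ
  Orthocomplemented = ∀ {p z} → p ≤ z → (p ′) ≤ z → 𝟙 ≤ z

  ≤-impl-𝟙 : ∀ i {s w} → implOf P i 𝟙 s w → s ≤ w
  ≤-impl-𝟙 C ((_ , s≤w) , _) = s≤w
  ≤-impl-𝟙 K {s} (_ , _ , _ , _ , _ , _ , _ , ((_ , s≤d) , _) , _ , (_ , t-greatest) , ((_ , t≤w) , _)) =
    ≤-trans (t-greatest s (𝟙-max s , s≤d)) t≤w
  ≤-impl-𝟙 N {s} (_ , _ , _ , _ , _ , _ , mb , _ , ((_ , b≤r) , _) , _ , ((r≤w , _) , _)) =
    ≤-trans ≤-′′ (≤-trans (≤-reflexive (sym (Max-L₂-≤ˡ (≤-trans ′′-≤ (≤-trans (𝟙-max s) ≤-′′)) mb)))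
                          (≤-trans b≤r r≤w))
  ≤-impl-𝟙 S {s} (_ , ma , ((_ , a≤w) , _)) =
    ≤-trans (≤-reflexive (sym (Max-L₂-≤ʳ (𝟙-max s) ma))) a≤w
  ≤-impl-𝟙 D (_ , _ , ((s≤w , _) , _)) = s≤w

  module _ (orth : Orthogonal) where

    ∧-exists : ∀ {x y} → (x ′) ⊥ (y ′) → ∃ (IsInf x y)
    ∧-exists {x} {y} x′⊥y′ with orth (x ′) (y ′) x′⊥y′
    ... | m , ((x′≤m , y′≤m) , least) =
      (m ′) , ((′-swapˡ x′≤m , ′-swapˡ y′≤m) , λ z (z≤x , z≤y) →
        ⊥-sym (least (z ′) (′-antitone z≤x , ′-antitone z≤y)))

    -- The join c ∨ a exists by orthogonality and is again a lower bound of p and q.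
    Max-L₂-absorbs : ∀ {p q a c} → Max (L₂ p q) a → L₂ p q c → c ⊥ a → c ≤ a
    Max-L₂-absorbs {p} {q} ((a≤p , a≤q) , maximal) (c≤p , c≤q) c⊥a with orth _ _ c⊥a
    ... | m , ((c≤m , a≤m) , least) =
      subst (_ ≤_) (maximal m (least p (c≤p , a≤p) , least q (c≤q , a≤q)) a≤m) c≤m

    →K-diag-≤ : ∀ {x z w} → (x ′) ≤ z → x ≤ z → →K x x w → w ≤ z
    →K-diag-≤ {z = z} x′≤z x≤z
      (_ , _ , _ , _ , _ , ((a≤x′ , _) , _) , ((b≤x′ , _) , _) , _ , (_ , r-least) , ((t≤x , _) , _) , (_ , w-least)) =
      w-least z (r-least z (≤-trans a≤x′ x′≤z , ≤-trans b≤x′ x′≤z) , ≤-trans t≤x x≤z)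

    impl-diag-≤ : ∀ i {p z w} → p ≤ z → (p ′) ≤ z → implOf P i p p w → w ≤ z
    impl-diag-≤ C {p} {z} {w} p≤z p′≤z (w∈U , minimal) with orth (p ′) p ≤-refl
    ... | j , (j∈U , least) = subst (_≤ z) (minimal j j∈U (least w w∈U)) (least z (p′≤z , p≤z))
    impl-diag-≤ K p≤z p′≤z w∈p⇒p = →K-diag-≤ p′≤z p≤z w∈p⇒p
    impl-diag-≤ N p≤z p′≤z w∈p⇒p = →K-diag-≤ (≤-trans ′′-≤ p≤z) p′≤z w∈p⇒p
    impl-diag-≤ S {z = z} p≤z p′≤z (_ , ((a≤p , _) , _) , (_ , w-least)) =
      w-least z (p′≤z , ≤-trans a≤p p≤z)
    impl-diag-≤ D {z = z} p≤z p′≤z (_ , ((b≤p′ , _) , _) , (_ , w-least)) =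
      w-least z (p≤z , ≤-trans b≤p′ p′≤z)

    Cond-i⇒orthocomplemented : ∀ i → Cond-i P i → Orthocomplemented
    Cond-i⇒orthocomplemented i reflects {p} {z} p≤z p′≤z =
      reflects p p 𝟙 z ≤-refl λ a b a∈p⇒p b∈𝟙⇒z →
        ≤-trans (impl-diag-≤ i p≤z p′≤z a∈p⇒p) (≤-impl-𝟙 i b∈𝟙⇒z)

    -- For w = (a ∨ b) ∨ (x ∧ d): w′ lies in L(x′, y) and is orthogonal to a, so w′ ≤ a ≤ w.
    →K-top : Orthocomplemented → ∀ {x y w} → x ≤ y → →K x y w → 𝟙 ≤ w
    →K-top oc {x} {y} {w} x≤y
      (a , b , _ , _ , _ , ma , mb , ((_ , y≤d) , _) , ((a≤r , b≤r) , _) , (_ , t-greatest) , ((r≤w , t≤w) , _)) =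
      oc ≤-refl (≤-trans w′≤a a≤w)
      where
      a≤w : a ≤ w
      a≤w = ≤-trans a≤r r≤w
      x≤w : x ≤ w
      x≤w = ≤-trans (t-greatest x (≤-refl , ≤-trans x≤y y≤d)) t≤w
      y′≤w : (y ′) ≤ w
      y′≤w = ≤-trans (≤-reflexive (sym (Max-L₂-≤ʳ (′-antitone x≤y) mb))) (≤-trans b≤r r≤w)
      w′≤a : (w ′) ≤ a
      w′≤a = Max-L₂-absorbs ma (′-antitone x≤w , ′-swapˡ y′≤w) (′-antitone a≤w)

    impl-top : Orthocomplemented → ∀ i {x y w} → x ≤ y → implOf P i x y w → 𝟙 ≤ w
    impl-top oc C x≤y ((x′≤w , y≤w) , _) = oc (≤-trans x≤y y≤w) x′≤w
    impl-top oc K x≤y w∈x⇒y = →K-top oc x≤y w∈x⇒y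
    impl-top oc N x≤y w∈x⇒y = →K-top oc (′-antitone x≤y) w∈x⇒y
    impl-top oc S x≤y (_ , ma , ((x′≤w , a≤w) , _)) =
      oc (≤-trans (≤-reflexive (sym (Max-L₂-≤ˡ x≤y ma))) a≤w) x′≤w
    impl-top oc D x≤y (_ , mb , ((y≤w , b≤w) , _)) =
      oc y≤w (≤-trans (≤-reflexive (sym (Max-L₂-≤ʳ (′-antitone x≤y) mb))) b≤w)

    module _ (lub : LubComplete) where

      Max-L₂-exists : ∀ p q → ∃ (Max (L₂ p q))
      Max-L₂-exists p q with lub (p ∷ q ∷ []) 𝟘 (𝟘-min p ∷ 𝟘-min q ∷ [])
      ... | a , ((a≤p ∷ a≤q ∷ []) , maximal) , _ =
        a , ((a≤p , a≤q) , λ z (z≤p , z≤q) → maximal z (z≤p ∷ z≤q ∷ []))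

      Min-U₂-exists : ∀ p q → ∃ (Min (U₂ p q))
      Min-U₂-exists p q with Max-L₂-exists (p ′) (q ′)
      ... | a , ((a≤p′ , a≤q′) , maximal) =
        (a ′) , ((⊥-sym a≤p′ , ⊥-sym a≤q′) , λ z (p≤z , q≤z) z≤a′ →
          trans (sym (′-invol z)) (cong _′ (maximal (z ′) (′-antitone p≤z , ′-antitone q≤z) (⊥-sym z≤a′))))

      →K-inhabited : ∀ x y → ∃ (→K x y)
      →K-inhabited x y with Max-L₂-exists (x ′) y | Max-L₂-exists (x ′) (y ′) | Min-U₂-exists (x ′) y
      ... | a , ma@((a≤x′ , a≤y) , _) | b , mb@((b≤x′ , b≤y′) , _) | d , md@((x′≤d , _) , _)
        with orth a b (≤-trans a≤y (⊥-sym b≤y′)) | ∧-exists {x} {d} (≤-trans x′≤d ≤-′′)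
      ... | r , r-sup@(_ , r-least) | t , t-inf@((t≤x , _) , _)
        with orth r t (≤-trans (r-least (x ′) (a≤x′ , b≤x′)) (′-antitone t≤x))
      ... | w , w-sup = w , a , b , d , r , t , ma , mb , md , r-sup , t-inf , w-sup

      impl-inhabited : ∀ i x y → ∃ (implOf P i x y)
      impl-inhabited C x y = Min-U₂-exists (x ′) y
      impl-inhabited K x y = →K-inhabited x y
      impl-inhabited N x y = →K-inhabited (y ′) (x ′)
      impl-inhabited S x y with Max-L₂-exists x y
      ... | a , ma@((a≤x , _) , _) with orth (x ′) a (′-antitone a≤x)
      ... | w , w-sup = w , a , ma , w-sup
      impl-inhabited D x y with Max-L₂-exists (x ′) (y ′)
      ... | b , mb@((_ , b≤y′) , _) with orth y b (⊥-sym b≤y′)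
      ... | w , w-sup = w , b , mb , w-sup

      orthocomplemented⇒≤⇒singleton : Orthocomplemented → ∀ i {x y} → x ≤ y → IsSingleton (implOf P i x y) 𝟙
      orthocomplemented⇒≤⇒singleton oc i {x} {y} x≤y = singleton-𝟙 (impl-inhabited i x y) λ w w∈x⇒y →
        ≤-antisym (𝟙-max w) (impl-top oc i x≤y w∈x⇒y)

theorem10 : {ℓ : Level} (P : BoundedInvPoset ℓ)
    → Notions.Orthogonal P → Notions.LubComplete P
    → (i : Impl) → Cond-i P i ⇔ Cond-ii P i
theorem10 P orth lub i = mk⇔ i⇒ii (characterises⇒reflects P (impl-inhabited P orth lub i))
  where
  i⇒ii : Cond-i P i → Cond-ii P i
  i⇒ii reflects x y = mk⇔
    (orthocomplemented⇒≤⇒singleton P orth lub (Cond-i⇒orthocomplemented P orth i reflects) i)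
    (reflects⇒singleton⇒≤ P reflects)
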